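{- Let $\alpha,\beta,\gamma,\delta$ be integers and let the Taylor (formal power series) expansion of $$ x(\alpha+\beta x)\prod_{k\ge1}\left(1+\gamma x^{2^k-1}+\delta x^{2^k}\right) $$ be $a(0)+a(1)x+a(2)x^2+\cdots$. Then $a(0)=0$, $a(1)=\alpha$, and for $n\ge2$, writing $n=2^k+i$ with $k\ge1$ and $0\le i\le 2^k-1$, $$ a(2^k+i)=\begin{cases} \alpha\gamma+\beta\delta^{k-1}, & i=0;\\ \delta a(i)+\gamma a(i+1), & i=1,\ldots,2^k-2;\\ \delta a(i)+\gamma a(i+1)-\alpha\gamma^2, & i=2^k-1.\end{cases} $$ -}

module Defs where

open import Data.Nat as ℕ using (ℕ; zero; suc)
open import Data.Integer using (ℤ; 0ℤ; 1ℤ; _+_; _*_)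
open import Data.List using (List; []; _∷_; replicate; _++_; map)

-- Polynomials with integer coefficients, as coefficient lists
-- (constant term first).
Poly : Set
Poly = List ℤ

infixl 6 _+ₚ_
infixl 7 _*ₚ_

_+ₚ_ : Poly → Poly → Poly
[]      +ₚ q       = q
(a ∷ p) +ₚ []      = a ∷ p
(a ∷ p) +ₚ (b ∷ q) = (a + b) ∷ (p +ₚ q)

_*ₚ_ : Poly → Poly → Poly
[]      *ₚ q = []
(a ∷ p) *ₚ q = map (a *_) q +ₚ (0ℤ ∷ (p *ₚ q))

coeff : Poly → ℕ → ℤ
coeff []      _       = 0ℤ
coeff (a ∷ p) zero    = a
coeff (a ∷ p) (suc n) = coeff p n

mono : ℤ → ℕ → Poly
mono c d = replicate d 0ℤ ++ (c ∷ [])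

factor : ℤ → ℤ → ℕ → Poly
factor γ δ k = (1ℤ ∷ []) +ₚ mono γ (2 ℕ.^ k ℕ.∸ 1) +ₚ mono δ (2 ℕ.^ k)

prodUpTo : ℤ → ℤ → ℕ → Poly
prodUpTo γ δ zero    = 1ℤ ∷ []
prodUpTo γ δ (suc K) = prodUpTo γ δ K *ₚ factor γ δ (suc K)

-- Coefficient a(n) of x^n in the formal power series
--   x(α + βx) ∏_{k≥1} (1 + γ x^(2^k-1) + δ x^(2^k)).
-- Factors with k > n have the form 1 + (terms of degree ≥ 2^k - 1 > n),
-- so they do not affect the coefficient of x^n; hence it equals the
-- coefficient of x^n in the partial product over k = 1..n.
a : ℤ → ℤ → ℤ → ℤ → ℕ → ℤ
a α β γ δ n = coeff ((0ℤ ∷ α ∷ β ∷ []) *ₚ prodUpTo γ δ n) n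

module Submission where

-- Multiplying a power series by the trinomial
-- 1 + γ x^(d-1) + δ x^d acts on its coefficient sequence f by
--   f ↦ (n ↦ f n + γ f(n-d+1) + δ f(n-d)),
-- so the coefficients g_K of  s · ∏_{k=1}^K (1 + γ x^(2^k-1) + δ x^(2^k)),
-- s = x(α + βx), obey  g_{K+1} = (that operation with d = 2^{K+1}) g_K.
-- Since g_K(0) = 0, this operation leaves coefficients below d unchanged,
-- so g_K(n) is already the final coefficient a(n) once n < 2^{K+1};
-- moreover g_K vanishes above 2^{K+1} and has leading coefficient β δ^K.
-- Reading off the coefficient at 2^{K+1} + i, for i < 2^{K+1}, in
-- g_{K+1} then gives all three cases of the recursion at once.

open import Defs
open import Data.Nat as ℕ using (ℕ; zero; suc; _≤_; _<_; z≤n; s≤s)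
import Data.Nat.Properties as ℕP
open import Data.Integer using (ℤ; 0ℤ; 1ℤ; _+_; _*_; _-_; _^_)
import Data.Integer.Properties as ℤP
open import Data.Integer.Tactic.RingSolver using (solve-∀)
open import Data.List using ([]; _∷_; map)
open import Data.Product using (_×_; _,_)
open import Data.Sum using (inj₁; inj₂)
open import Relation.Binary.PropositionalEquality
  using (_≡_; _≗_; refl; sym; trans; cong; cong₂; subst; module ≡-Reasoning)

Seq : Set
Seq = ℕ → ℤ

shift : ℕ → Seq → Seq
shift zero    f n       = f n
shift (suc d) f zero    = 0ℤ
shift (suc d) f (suc n) = shift d f n

unit : Seq
unit = coeff (1ℤ ∷ [])

VanishesAbove : ℕ → Seq → Set
VanishesAbove B f = ∀ n → B < n → f n ≡ 0ℤ

shift-ext : ∀ d {f g} → f ≗ g → shift d f ≗ shift d g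
shift-ext zero    f≗g n       = f≗g n
shift-ext (suc d) f≗g zero    = refl
shift-ext (suc d) f≗g (suc n) = shift-ext d f≗g n

shift-at : ∀ d f m → shift d f (d ℕ.+ m) ≡ f m
shift-at zero    f m = refl
shift-at (suc d) f m = shift-at d f m

-- Below the shift only the constant term of f can appear.
shift-below : ∀ {d n} f → f 0 ≡ 0ℤ → n ≤ d → shift d f n ≡ 0ℤ
shift-below {zero}  f f0≡0 z≤n       = f0≡0
shift-below {suc d} f f0≡0 z≤n       = refl
shift-below {suc d} f f0≡0 (s≤s n≤d) = shift-below f f0≡0 n≤d

shift-vanishes : ∀ d {B f} → VanishesAbove B f → VanishesAbove (d ℕ.+ B) (shift d f)
shift-vanishes zero    vf n       B<n       = vf n B<n
shift-vanishes (suc d) vf (suc n) (s≤s d+B<n) = shift-vanishes d vf n d+B<n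

coeff-+ : ∀ p q n → coeff (p +ₚ q) n ≡ coeff p n + coeff q n
coeff-+ []      q       n       = sym (ℤP.+-identityˡ _)
coeff-+ (c ∷ p) []      n       = sym (ℤP.+-identityʳ _)
coeff-+ (c ∷ p) (d ∷ q) zero    = refl
coeff-+ (c ∷ p) (d ∷ q) (suc n) = coeff-+ p q n

coeff-scale : ∀ c q n → coeff (map (c *_) q) n ≡ c * coeff q n
coeff-scale c []      n       = sym (ℤP.*-zeroʳ c)
coeff-scale c (d ∷ q) zero    = refl
coeff-scale c (d ∷ q) (suc n) = coeff-scale c q n

conv : Poly → Seq → Seq
conv []      f n       = 0ℤ
conv (c ∷ p) f zero    = c * f zero
conv (c ∷ p) f (suc n) = c * f (suc n) + conv p f n

coeff-* : ∀ p q n → coeff (p *ₚ q) n ≡ conv p (coeff q) n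
coeff-* []      q n = refl
coeff-* (c ∷ p) q n = begin
    coeff (map (c *_) q +ₚ (0ℤ ∷ p *ₚ q)) n
  ≡⟨ coeff-+ (map (c *_) q) _ n ⟩
    coeff (map (c *_) q) n + coeff (0ℤ ∷ p *ₚ q) n
  ≡⟨ cong (_+ coeff (0ℤ ∷ p *ₚ q) n) (coeff-scale c q n) ⟩
    c * coeff q n + coeff (0ℤ ∷ p *ₚ q) n
  ≡⟨ tail n ⟩
    conv (c ∷ p) (coeff q) n ∎
  where
    open ≡-Reasoning
    tail : ∀ n → c * coeff q n + coeff (0ℤ ∷ p *ₚ q) n ≡ conv (c ∷ p) (coeff q) n
    tail zero    = ℤP.+-identityʳ _
    tail (suc n) = cong (c * coeff q (suc n) +_) (coeff-* p q n)

conv-unit : ∀ p → conv p unit ≗ coeff p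
conv-unit []      n       = refl
conv-unit (c ∷ p) zero    = ℤP.*-identityʳ c
conv-unit (c ∷ p) (suc n) = begin
    c * 0ℤ + conv p unit n  ≡⟨ cong₂ _+_ (ℤP.*-zeroʳ c) (conv-unit p n) ⟩
    0ℤ + coeff p n          ≡⟨ ℤP.+-identityˡ _ ⟩
    coeff p n               ∎
  where open ≡-Reasoning

conv-ext : ∀ p {f g} → f ≗ g → conv p f ≗ conv p g
conv-ext []      f≗g n       = refl
conv-ext (c ∷ p) f≗g zero    = cong (c *_) (f≗g zero)
conv-ext (c ∷ p) f≗g (suc n) = cong₂ _+_ (cong (c *_) (f≗g (suc n))) (conv-ext p f≗g n)

conv-+ : ∀ p f g → conv p (λ m → f m + g m) ≗ λ n → conv p f n + conv p g n
conv-+ []      f g n       = refl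
conv-+ (c ∷ p) f g zero    = ℤP.*-distribˡ-+ c (f 0) (g 0)
conv-+ (c ∷ p) f g (suc n) = begin
    c * (f (suc n) + g (suc n)) + conv p (λ m → f m + g m) n
  ≡⟨ cong (c * (f (suc n) + g (suc n)) +_) (conv-+ p f g n) ⟩
    c * (f (suc n) + g (suc n)) + (conv p f n + conv p g n)
  ≡⟨ regroup c (f (suc n)) (g (suc n)) (conv p f n) (conv p g n) ⟩
    (c * f (suc n) + conv p f n) + (c * g (suc n) + conv p g n) ∎
  where
    open ≡-Reasoning
    regroup : ∀ c x y u v → c * (x + y) + (u + v) ≡ (c * x + u) + (c * y + v)
    regroup = solve-∀

conv-scale : ∀ p c f → conv p (λ m → c * f m) ≗ λ n → c * conv p f n
conv-scale []      c f n       = sym (ℤP.*-zeroʳ c)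
conv-scale (b ∷ p) c f zero    = swap b c (f 0)
  where
    swap : ∀ b c x → b * (c * x) ≡ c * (b * x)
    swap = solve-∀
conv-scale (b ∷ p) c f (suc n) = begin
    b * (c * f (suc n)) + conv p (λ m → c * f m) n
  ≡⟨ cong (b * (c * f (suc n)) +_) (conv-scale p c f n) ⟩
    b * (c * f (suc n)) + c * conv p f n
  ≡⟨ factor-out b c (f (suc n)) (conv p f n) ⟩
    c * (b * f (suc n) + conv p f n) ∎
  where
    open ≡-Reasoning
    factor-out : ∀ b c x y → b * (c * x) + c * y ≡ c * (b * x + y)
    factor-out = solve-∀

conv-shift₁ : ∀ p f → conv p (shift 1 f) ≗ shift 1 (conv p f)
conv-shift₁ []      f zero          = refl
conv-shift₁ []      f (suc n)       = refl
conv-shift₁ (c ∷ p) f zero          = ℤP.*-zeroʳ c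
conv-shift₁ (c ∷ p) f (suc zero)    =
  trans (cong (c * f 0 +_) (conv-shift₁ p f 0)) (ℤP.+-identityʳ _)
conv-shift₁ (c ∷ p) f (suc (suc n)) = cong (c * f (suc n) +_) (conv-shift₁ p f (suc n))

conv-shift : ∀ p d f → conv p (shift d f) ≗ shift d (conv p f)
conv-shift p zero    f n = refl
conv-shift p (suc d) f n = begin
    conv p (shift (suc d) f) n       ≡⟨ conv-ext p shift-suc n ⟩
    conv p (shift 1 (shift d f)) n   ≡⟨ conv-shift₁ p (shift d f) n ⟩
    shift 1 (conv p (shift d f)) n   ≡⟨ shift-ext 1 (conv-shift p d f) n ⟩
    shift 1 (shift d (conv p f)) n   ≡⟨ sym (shift-suc n) ⟩
    shift (suc d) (conv p f) n       ∎
  where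
    open ≡-Reasoning
    shift-suc : ∀ {g} → shift (suc d) g ≗ shift 1 (shift d g)
    shift-suc zero    = refl
    shift-suc (suc n) = refl

coeff-mono : ∀ c d → coeff (mono c d) ≗ λ m → c * shift d unit m
coeff-mono c zero    zero    = sym (ℤP.*-identityʳ c)
coeff-mono c zero    (suc m) = sym (ℤP.*-zeroʳ c)
coeff-mono c (suc d) zero    = sym (ℤP.*-zeroʳ c)
coeff-mono c (suc d) (suc m) = coeff-mono c d m

module Trinomial (γ δ : ℤ) where

  mulTrinomial : ℕ → Seq → Seq
  mulTrinomial d f n = f n + γ * shift (d ℕ.∸ 1) f n + δ * shift d f n

  mulTrinomial-ext : ∀ d {f g} → f ≗ g → mulTrinomial d f ≗ mulTrinomial d g
  mulTrinomial-ext d f≗g n =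
    cong₂ _+_ (cong₂ _+_ (f≗g n) (cong (γ *_) (shift-ext (d ℕ.∸ 1) f≗g n)))
              (cong (δ *_) (shift-ext d f≗g n))

  conv-mulTrinomial : ∀ p d f → conv p (mulTrinomial d f) ≗ mulTrinomial d (conv p f)
  conv-mulTrinomial p d f n = begin
      conv p (mulTrinomial d f) n
    ≡⟨ conv-+ p (λ m → f m + γ * shift d₁ f m) (λ m → δ * shift d f m) n ⟩
      conv p (λ m → f m + γ * shift d₁ f m) n + conv p (λ m → δ * shift d f m) n
    ≡⟨ cong₂ _+_ (conv-+ p f (λ m → γ * shift d₁ f m) n) (conv-scale p δ (shift d f) n) ⟩
      conv p f n + conv p (λ m → γ * shift d₁ f m) n + δ * conv p (shift d f) n
    ≡⟨ cong₂ (λ u v → conv p f n + u + δ * v)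
             (trans (conv-scale p γ (shift d₁ f) n) (cong (γ *_) (conv-shift p d₁ f n)))
             (conv-shift p d f n) ⟩
      mulTrinomial d (conv p f) n ∎
    where
      open ≡-Reasoning
      d₁ = d ℕ.∸ 1

  coeff-factor : ∀ k → coeff (factor γ δ k) ≗ mulTrinomial (2 ℕ.^ k) unit
  coeff-factor k m =
    trans (coeff-+ ((1ℤ ∷ []) +ₚ mono γ d₁) (mono δ d) m)
      (cong₂ _+_ (trans (coeff-+ (1ℤ ∷ []) (mono γ d₁) m) (cong (unit m +_) (coeff-mono γ d₁ m)))
                 (coeff-mono δ d m))
    where
      d  = 2 ℕ.^ k
      d₁ = d ℕ.∸ 1

  coeff-*-factor : ∀ P k → coeff (P *ₚ factor γ δ k) ≗ mulTrinomial (2 ℕ.^ k) (coeff P)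
  coeff-*-factor P k n = begin
      coeff (P *ₚ factor γ δ k) n                ≡⟨ coeff-* P (factor γ δ k) n ⟩
      conv P (coeff (factor γ δ k)) n            ≡⟨ conv-ext P (coeff-factor k) n ⟩
      conv P (mulTrinomial (2 ℕ.^ k) unit) n     ≡⟨ conv-mulTrinomial P (2 ℕ.^ k) unit n ⟩
      mulTrinomial (2 ℕ.^ k) (conv P unit) n     ≡⟨ mulTrinomial-ext (2 ℕ.^ k) (conv-unit P) n ⟩
      mulTrinomial (2 ℕ.^ k) (coeff P) n         ∎
    where open ≡-Reasoning

  mulTrinomial-low : ∀ {d n} f → f 0 ≡ 0ℤ → n < d → mulTrinomial d f n ≡ f n
  mulTrinomial-low {suc d} {n} f f0≡0 (s≤s n≤d) = begin
      f n + γ * shift d f n + δ * shift (suc d) f n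
    ≡⟨ cong₂ (λ u v → f n + γ * u + δ * v)
             (shift-below f f0≡0 n≤d) (shift-below f f0≡0 (ℕP.m≤n⇒m≤1+n n≤d)) ⟩
      f n + γ * 0ℤ + δ * 0ℤ
    ≡⟨ drop-zeros γ δ (f n) ⟩
      f n ∎
    where
      open ≡-Reasoning
      drop-zeros : ∀ c e x → x + c * 0ℤ + e * 0ℤ ≡ x
      drop-zeros = solve-∀

  mulTrinomial-upper : ∀ {d} f i → 1 ≤ d →
    mulTrinomial d f (d ℕ.+ i) ≡ f (d ℕ.+ i) + γ * f (suc i) + δ * f i
  mulTrinomial-upper {suc d} f i _ =
    cong₂ (λ u v → f (suc d ℕ.+ i) + γ * u + δ * v)
      (trans (cong (shift d f) (sym (ℕP.+-suc d i))) (shift-at d f (suc i)))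
      (shift-at d f i)

  mulTrinomial-vanishes : ∀ d {B f} → VanishesAbove B f → VanishesAbove (d ℕ.+ B) (mulTrinomial d f)
  mulTrinomial-vanishes d {B} {f} vf n d+B<n = begin
      f n + γ * shift (d ℕ.∸ 1) f n + δ * shift d f n
    ≡⟨ cong₂ (λ x y → x + γ * y + δ * shift d f n)
             (vf n (ℕP.≤-<-trans (ℕP.m≤n+m B d) d+B<n))
             (shift-vanishes (d ℕ.∸ 1) vf n
               (ℕP.≤-<-trans (ℕP.+-monoˡ-≤ B (ℕP.m∸n≤m d 1)) d+B<n)) ⟩
      0ℤ + γ * 0ℤ + δ * shift d f n
    ≡⟨ cong (λ z → 0ℤ + γ * 0ℤ + δ * z) (shift-vanishes d vf n d+B<n) ⟩
      0ℤ + γ * 0ℤ + δ * 0ℤ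
    ≡⟨ all-zero γ δ ⟩
      0ℤ ∎
    where
      open ≡-Reasoning
      all-zero : ∀ c e → 0ℤ + c * 0ℤ + e * 0ℤ ≡ 0ℤ
      all-zero = solve-∀

  mulTrinomial-leading : ∀ {d B f} → VanishesAbove B f → 1 ≤ d →
    mulTrinomial d f (d ℕ.+ B) ≡ δ * f B
  mulTrinomial-leading {d} {B} {f} vf 1≤d = begin
      mulTrinomial d f (d ℕ.+ B)
    ≡⟨ mulTrinomial-upper f B 1≤d ⟩
      f (d ℕ.+ B) + γ * f (suc B) + δ * f B
    ≡⟨ cong₂ (λ x y → x + γ * y + δ * f B)
             (vf (d ℕ.+ B) (ℕP.+-monoˡ-≤ B 1≤d)) (vf (suc B) ℕP.≤-refl) ⟩
      0ℤ + γ * 0ℤ + δ * f B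
    ≡⟨ only-top γ δ (f B) ⟩
      δ * f B ∎
    where
      open ≡-Reasoning
      only-top : ∀ c e x → 0ℤ + c * 0ℤ + e * x ≡ e * x
      only-top = solve-∀

pow2-pos : ∀ k → 1 ≤ 2 ℕ.^ k
pow2-pos k = ℕP.m^n>0 2 k

2≤pow2-suc : ∀ k → 2 ≤ 2 ℕ.^ suc k
2≤pow2-suc k = ℕP.^-monoʳ-≤ 2 {1} {suc k} (s≤s z≤n)

pow2-suc : ∀ k → 2 ℕ.^ suc k ≡ 2 ℕ.^ k ℕ.+ 2 ℕ.^ k
pow2-suc k = cong (2 ℕ.^ k ℕ.+_) (ℕP.+-identityʳ (2 ℕ.^ k))

n<pow2-suc : ∀ n → n < 2 ℕ.^ suc n
n<pow2-suc zero    = s≤s z≤n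
n<pow2-suc (suc n) = subst (suc n <_) (sym (pow2-suc (suc n)))
  (ℕP.≤-trans (s≤s (n<pow2-suc n)) (ℕP.+-monoˡ-≤ (2 ℕ.^ suc n) (pow2-pos (suc n))))

module Series (α β γ δ : ℤ) where
  open Trinomial γ δ

  s : Poly
  s = 0ℤ ∷ α ∷ β ∷ []

  A : Seq
  A = a α β γ δ

  g : ℕ → Seq
  g K = conv s (coeff (prodUpTo γ δ K))

  g-base : g 0 ≗ coeff s
  g-base = conv-unit s

  g-step : ∀ K → g (suc K) ≗ mulTrinomial (2 ℕ.^ suc K) (g K)
  g-step K n = trans (conv-ext s (coeff-*-factor (prodUpTo γ δ K) (suc K)) n)
                     (conv-mulTrinomial s (2 ℕ.^ suc K) (coeff (prodUpTo γ δ K)) n)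

  g-zero : ∀ K → g K 0 ≡ 0ℤ
  g-zero zero    = g-base 0
  g-zero (suc K) = trans (g-step K 0) (trans (mulTrinomial-low (g K) (g-zero K) (pow2-pos (suc K))) (g-zero K))

  g-vanishes : ∀ K → VanishesAbove (2 ℕ.^ suc K) (g K)
  g-vanishes zero    n (s≤s (s≤s (s≤s _))) = g-base n
  g-vanishes (suc K) n lt = trans (g-step K n)
    (mulTrinomial-vanishes (2 ℕ.^ suc K) (g-vanishes K) n (subst (_< n) (pow2-suc (suc K)) lt))

  g-top : ∀ K → g K (2 ℕ.^ suc K) ≡ β * δ ^ K
  g-top zero    = trans (g-base 2) (sym (ℤP.*-identityʳ β))
  g-top (suc K) = begin
      g (suc K) (2 ℕ.^ suc (suc K))  ≡⟨ cong (g (suc K)) (pow2-suc (suc K)) ⟩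
      g (suc K) (E ℕ.+ E)            ≡⟨ g-step K (E ℕ.+ E) ⟩
      mulTrinomial E (g K) (E ℕ.+ E) ≡⟨ mulTrinomial-leading (g-vanishes K) (pow2-pos (suc K)) ⟩
      δ * g K E                      ≡⟨ cong (δ *_) (g-top K) ⟩
      δ * (β * δ ^ K)                ≡⟨ swap δ β (δ ^ K) ⟩
      β * (δ * δ ^ K)                ∎
    where
      open ≡-Reasoning
      E = 2 ℕ.^ suc K
      swap : ∀ x y z → x * (y * z) ≡ y * (x * z)
      swap = solve-∀

  g-stable : ∀ d K {n} → n < 2 ℕ.^ suc K → g (d ℕ.+ K) n ≡ g K n
  g-stable zero    K lt = refl
  g-stable (suc d) K {n} lt = trans (g-step (d ℕ.+ K) n)
    (trans (mulTrinomial-low (g (d ℕ.+ K)) (g-zero (d ℕ.+ K))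
              (ℕP.<-≤-trans lt (ℕP.^-monoʳ-≤ 2 (s≤s (ℕP.m≤n+m K d)))))
           (g-stable d K lt))

  a-eq-g : ∀ K {n} → n < 2 ℕ.^ suc K → A n ≡ g K n
  a-eq-g K {n} lt with ℕP.≤-total K n
  ... | inj₁ K≤n = begin
      A n                        ≡⟨ coeff-* s (prodUpTo γ δ n) n ⟩
      g n n                      ≡⟨ cong (λ L → g L n) (sym (ℕP.m∸n+n≡m K≤n)) ⟩
      g (n ℕ.∸ K ℕ.+ K) n        ≡⟨ g-stable (n ℕ.∸ K) K lt ⟩
      g K n                      ∎
    where open ≡-Reasoning
  ... | inj₂ n≤K = begin
      A n                        ≡⟨ coeff-* s (prodUpTo γ δ n) n ⟩
      g n n                      ≡⟨ sym (g-stable (K ℕ.∸ n) n (n<pow2-suc n)) ⟩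
      g (K ℕ.∸ n ℕ.+ n) n        ≡⟨ cong (λ L → g L n) (ℕP.m∸n+n≡m n≤K) ⟩
      g K n                      ∎
    where open ≡-Reasoning

  a-upper : ∀ K {i} → i < 2 ℕ.^ suc K →
    A (2 ℕ.^ suc K ℕ.+ i) ≡ g K (2 ℕ.^ suc K ℕ.+ i) + γ * g K (suc i) + δ * g K i
  a-upper K {i} i<E = begin
      A (E ℕ.+ i)                 ≡⟨ a-eq-g (suc K) E+i<2E ⟩
      g (suc K) (E ℕ.+ i)         ≡⟨ g-step K (E ℕ.+ i) ⟩
      mulTrinomial E (g K) (E ℕ.+ i) ≡⟨ mulTrinomial-upper (g K) i (pow2-pos (suc K)) ⟩
      g K (E ℕ.+ i) + γ * g K (suc i) + δ * g K i ∎
    where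
      open ≡-Reasoning
      E = 2 ℕ.^ suc K
      E+i<2E : E ℕ.+ i < 2 ℕ.^ suc (suc K)
      E+i<2E = subst (E ℕ.+ i <_) (sym (pow2-suc (suc K))) (ℕP.+-monoʳ-< E i<E)

  rhs-cong : ∀ {x x′ y y′ z z′} → x ≡ x′ → y ≡ y′ → z ≡ z′ →
             x + γ * y + δ * z ≡ x′ + γ * y′ + δ * z′
  rhs-cong refl refl refl = refl

  a-zero : A 0 ≡ 0ℤ
  a-zero = trans (a-eq-g 0 (s≤s z≤n)) (g-zero 0)

  a-one : A 1 ≡ α
  a-one = trans (a-eq-g 0 (s≤s (s≤s z≤n))) (g-base 1)

  a-power : ∀ K → A (2 ℕ.^ suc K) ≡ α * γ + β * δ ^ K
  a-power K = begin
      A E                                         ≡⟨ cong A (sym (ℕP.+-identityʳ E)) ⟩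
      A (E ℕ.+ 0)                                 ≡⟨ a-upper K (pow2-pos (suc K)) ⟩
      g K (E ℕ.+ 0) + γ * g K 1 + δ * g K 0
        ≡⟨ rhs-cong (trans (cong (g K) (ℕP.+-identityʳ E)) (g-top K))
                    (trans (sym (a-eq-g K (2≤pow2-suc K))) a-one) (g-zero K) ⟩
      β * δ ^ K + γ * α + δ * 0ℤ                  ≡⟨ rearrange α β γ δ (δ ^ K) ⟩
      α * γ + β * δ ^ K                           ∎
    where
      open ≡-Reasoning
      E = 2 ℕ.^ suc K
      rearrange : ∀ α β γ δ t → β * t + γ * α + δ * 0ℤ ≡ α * γ + β * t
      rearrange = solve-∀

  -- Case 1 ≤ i ≤ 2^(K+1) - 2: the term g K (E + i) lies above the degree.
  a-middle : ∀ K {i} → 1 ≤ i → i ≤ 2 ℕ.^ suc K ℕ.∸ 2 →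
    A (2 ℕ.^ suc K ℕ.+ i) ≡ δ * A i + γ * A (suc i)
  a-middle K {i} 1≤i i≤E∸2 = begin
      A (E ℕ.+ i)                                  ≡⟨ a-upper K i<E ⟩
      g K (E ℕ.+ i) + γ * g K (suc i) + δ * g K i
        ≡⟨ rhs-cong (g-vanishes K (E ℕ.+ i) (ℕP.m<m+n E 1≤i))
                    (sym (a-eq-g K 1+i<E)) (sym (a-eq-g K i<E)) ⟩
      0ℤ + γ * A (suc i) + δ * A i                 ≡⟨ rearrange γ δ (A (suc i)) (A i) ⟩
      δ * A i + γ * A (suc i)                      ∎
    where
      open ≡-Reasoning
      E = 2 ℕ.^ suc K
      1+i<E : suc i < E
      1+i<E = subst (_≤ E) (ℕP.+-comm i 2) (ℕP.m≤o∸n⇒m+n≤o i (2≤pow2-suc K) i≤E∸2)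
      i<E : i < E
      i<E = ℕP.<-trans (ℕP.n<1+n i) 1+i<E
      rearrange : ∀ γ δ y z → 0ℤ + γ * y + δ * z ≡ δ * z + γ * y
      rearrange = solve-∀

  -- Case i = 2^(K+1) - 1: here g K (i + 1) is the leading coefficient β δ^K,
  -- which differs from a(2^(K+1)) by α γ.
  a-last : ∀ K → let E = 2 ℕ.^ suc K in
    A (E ℕ.+ (E ℕ.∸ 1)) ≡ δ * A (E ℕ.∸ 1) + γ * A (suc (E ℕ.∸ 1)) - α * γ ^ 2
  a-last K = begin
      A (E ℕ.+ P)                                  ≡⟨ a-upper K P<E ⟩
      g K (E ℕ.+ P) + γ * g K (suc P) + δ * g K P
        ≡⟨ rhs-cong (g-vanishes K (E ℕ.+ P) (ℕP.m<m+n E (ℕP.∸-monoˡ-≤ 1 (2≤pow2-suc K))))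
                    (trans (cong (g K) 1+P≡E) (g-top K)) (sym (a-eq-g K P<E)) ⟩
      0ℤ + γ * (β * δ ^ K) + δ * A P
        ≡⟨ rearrange α β γ δ (δ ^ K) (A P) ⟩
      δ * A P + γ * (α * γ + β * δ ^ K) - α * γ ^ 2
        ≡⟨ cong (λ y → δ * A P + γ * y - α * γ ^ 2) (sym (trans (cong A 1+P≡E) (a-power K))) ⟩
      δ * A P + γ * A (suc P) - α * γ ^ 2          ∎
    where
      open ≡-Reasoning
      E = 2 ℕ.^ suc K
      P = E ℕ.∸ 1
      1+P≡E : suc P ≡ E
      1+P≡E = ℕP.suc-pred E {{ℕ.>-nonZero (pow2-pos (suc K))}}
      P<E : P < E
      P<E = subst (P <_) 1+P≡E ℕP.≤-refl
      -- γ ^ 2 unfolds definitionally to γ * (γ * 1).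
      rearrange : ∀ α β γ δ t x →
        0ℤ + γ * (β * t) + δ * x ≡ δ * x + γ * (α * γ + β * t) - α * (γ * (γ * 1ℤ))
      rearrange = solve-∀

theorem6 : (α β γ δ : ℤ) →
      (a α β γ δ 0 ≡ 0ℤ)
    × (a α β γ δ 1 ≡ α)
    × (∀ (k : ℕ) → 1 ≤ k →
         a α β γ δ (2 ℕ.^ k) ≡ α * γ + β * δ ^ (k ℕ.∸ 1))
    × (∀ (k i : ℕ) → 1 ≤ k → 1 ≤ i → i ≤ 2 ℕ.^ k ℕ.∸ 2 →
         a α β γ δ (2 ℕ.^ k ℕ.+ i) ≡ δ * a α β γ δ i + γ * a α β γ δ (suc i))
    × (∀ (k : ℕ) → 1 ≤ k →
         a α β γ δ (2 ℕ.^ k ℕ.+ (2 ℕ.^ k ℕ.∸ 1))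
           ≡ δ * a α β γ δ (2 ℕ.^ k ℕ.∸ 1) + γ * a α β γ δ (suc (2 ℕ.^ k ℕ.∸ 1))
             - α * γ ^ 2)
theorem6 α β γ δ =
    a-zero
  , a-one
  , (λ { (suc K) _ → a-power K })
  , (λ { (suc K) i _ 1≤i i≤E∸2 → a-middle K 1≤i i≤E∸2 })
  , (λ { (suc K) _ → a-last K })
  where open Series α β γ δ
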